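{- Let $N = q^k n^2$ be an odd perfect number given in Eulerian form. Define $H = \gcd(n^2,\sigma(n^2))$, $I = \gcd(n,\sigma(n^2))$ and $J = H/I$. If $H$ is squarefree, then $J = 1$.
   Context: $\sigma(x)$ denotes the sum of the positive divisors of $x$. A positive integer $N$ is perfect if $\sigma(N)=2N$. An odd perfect number $N$ is said to be given in Eulerian form $N = q^k n^2$ if $q$ is a prime (the special prime), $k$ and $n$ are positive integers, $q \equiv k \equiv 1 \pmod 4$, and $\gcd(q,n)=1$. -}

module Defs where

open import Data.Nat using (ℕ; zero; suc; _+_; _*_; _^_; _/_)
open import Data.Nat.Divisibility using (_∣_; _∣?_)
open import Data.Nat.GCD using (gcd)
open import Data.Nat.Primality using (Prime)
open import Data.List using (List; upTo; filter; map)
open import Data.Nat.ListAction using (sum)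
open import Data.Product using (_×_; Σ; ∃)
open import Relation.Binary.PropositionalEquality using (_≡_)

divisors : ℕ → List ℕ
divisors x = filter (_∣? x) (map suc (upTo x))

σ : ℕ → ℕ
σ x = sum (divisors x)

Perfect : ℕ → Set
Perfect N = σ N ≡ 2 * N

Odd : ℕ → Set
Odd m = ∃ λ t → m ≡ 2 * t + 1

EulerianForm : ℕ → ℕ → ℕ → ℕ → Set
EulerianForm N q k n =
  Prime q × (∃ λ a → q ≡ 4 * a + 1) × (∃ λ b → k ≡ 4 * b + 1)
  × (∃ λ c → n ≡ suc c) × gcd q n ≡ 1 × N ≡ q ^ k * (n * n)

Squarefree : ℕ → Set
Squarefree x = ∀ d → d * d ∣ x → d ≡ 1

-- natural-number division with a nonzero divisor (the divisor here, I = gcd(n, σ(n²)), is ≥ 1 since n ≥ 1)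
_div_ : ℕ → ℕ → ℕ
m div zero = 0
m div suc d = m / suc d

H : ℕ → ℕ
H n = gcd (n * n) (σ (n * n))

I : ℕ → ℕ
I n = gcd n (σ (n * n))

J : ℕ → ℕ
J n = H n div I n

-- A squarefree divisor of a square divides its root: if h is squarefree and h ∣ m², write
-- h = a·g and m = b·g with g = gcd(h, m) and a, b coprime; then a ∣ b²g forces a ∣ g, so a² ∣ h
-- and a = 1. Hence H = gcd(n², σ(n²)) divides n, which gives H = I and J = 1.
module Submission where

open import Defs
open import Data.Nat using (ℕ; zero; suc; _*_; ≢-nonZero)
open import Data.Nat.Properties using (*-comm; *-assoc; *-cancelˡ-≡; *-identityʳ; *-identityˡ)
open import Data.Nat.Divisibility
open import Data.Nat.DivMod using (n/n≡1)
open import Data.Nat.GCD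
open import Data.Nat.Coprimality using (Coprime; coprime-divisor; gcd≡1⇒coprime)
open import Data.Product using (_,_)
open import Relation.Binary.PropositionalEquality
  using (_≡_; _≢_; refl; sym; trans; cong; cong₂; subst; subst₂; module ≡-Reasoning)

open ≡-Reasoning

gcd-cofactors-coprime : ∀ {h m a b} → h ≡ a * gcd h m → m ≡ b * gcd h m → gcd h m ≢ 0
                        → Coprime a b
gcd-cofactors-coprime {h} {m} {a} {b} h≡ag m≡bg g≢0 =
  gcd≡1⇒coprime (*-cancelˡ-≡ (gcd a b) 1 g {{≢-nonZero g≢0}} g*gcd≡g*1)
  where
  g = gcd h m
  g*gcd≡g*1 : g * gcd a b ≡ g * 1
  g*gcd≡g*1 = begin
    g * gcd a b             ≡⟨ c*gcd[m,n]≡gcd[cm,cn] g a b ⟩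
    gcd (g * a) (g * b)     ≡⟨ cong₂ gcd (trans (*-comm g a) (sym h≡ag)) (trans (*-comm g b) (sym m≡bg)) ⟩
    g                       ≡⟨ sym (*-identityʳ g) ⟩
    g * 1                   ∎

squarefree-∣-square⇒∣ : ∀ {h m} → Squarefree h → h ∣ m * m → h ∣ m
squarefree-∣-square⇒∣ {h} {zero} _ _ = h ∣0
squarefree-∣-square⇒∣ {h} {m@(suc _)} sq h∣m² with gcd[m,n]∣m h m | gcd[m,n]∣n h m
... | divides a h≡ag | divides b m≡bg = subst (_∣ m) (sym h≡g) (gcd[m,n]∣n h m)
  where
  g = gcd h m
  g≢0 : g ≢ 0
  g≢0 g≡0 with gcd[m,n]≡0⇒n≡0 h g≡0
  ... | ()
  a⊥b : Coprime a b
  a⊥b = gcd-cofactors-coprime h≡ag m≡bg g≢0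
  m²≡b[bg]*g : m * m ≡ b * (b * g) * g
  m²≡b[bg]*g = begin
    m * m                   ≡⟨ cong₂ _*_ m≡bg m≡bg ⟩
    b * g * (b * g)         ≡⟨ *-assoc b g (b * g) ⟩
    b * (g * (b * g))       ≡⟨ cong (b *_) (*-comm g (b * g)) ⟩
    b * (b * g * g)         ≡⟨ sym (*-assoc b (b * g) g) ⟩
    b * (b * g) * g         ∎
  a∣g : a ∣ g
  a∣g = coprime-divisor a⊥b (coprime-divisor a⊥b
          (*-cancelʳ-∣ g {{≢-nonZero g≢0}} (subst₂ _∣_ h≡ag m²≡b[bg]*g h∣m²)))
  h≡g : h ≡ g
  h≡g = begin
    h                       ≡⟨ h≡ag ⟩
    a * g                   ≡⟨ cong (_* g) (sq a (subst (a * a ∣_) (sym h≡ag) (*-monoʳ-∣ a a∣g))) ⟩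
    1 * g                   ≡⟨ *-identityˡ g ⟩
    g                       ∎

gcd-square-squarefree≡gcd : ∀ m s → Squarefree (gcd (m * m) s) → gcd (m * m) s ≡ gcd m s
gcd-square-squarefree≡gcd m s sq = ∣-antisym
  (gcd-greatest (squarefree-∣-square⇒∣ {m = m} sq (gcd[m,n]∣m (m * m) s)) (gcd[m,n]∣n (m * m) s))
  (gcd-greatest (∣-trans (gcd[m,n]∣m m s) (m∣m*n m)) (gcd[m,n]∣n m s))

div-self : ∀ {d} → d ≢ 0 → d div d ≡ 1
div-self {zero}    d≢0 with d≢0 refl
... | ()
div-self {d@(suc _)} _ = n/n≡1 d

theorem4 : (N q k n : ℕ) → Odd N → Perfect N → EulerianForm N q k n
    → Squarefree (H n) → J n ≡ 1
theorem4 N q k n _ _ (_ , _ , _ , (c , n≡suc) , _ , _) sq = begin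
  H n div I n               ≡⟨ cong (_div I n) (gcd-square-squarefree≡gcd n (σ (n * n)) sq) ⟩
  I n div I n               ≡⟨ div-self I≢0 ⟩
  1                         ∎
  where
  I≢0 : I n ≢ 0
  I≢0 I≡0 with trans (sym n≡suc) (gcd[m,n]≡0⇒m≡0 {n} {σ (n * n)} I≡0)
  ... | ()
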